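{- Let $S$ be a star graph and let $I$ be a subset of the leaves of $S$. For every internal edge $u-v$ of $S^I$, the bidirected-edge inequality $\mathbb{1}_{v\leftarrow u}(x)+\mathbb{1}_{u\leftarrow v}(x)\le1$ is valid for $\mathrm{CIM}_S^I$ and defines a facet of $\mathrm{CIM}_S^I$.
   Context: A star graph is a tree on at least $3$ nodes with one center node and all other nodes leaves. For a DAG $\mathcal{G}$ with skeleton $S$, $\mathcal{G}^I$ is obtained by adding a new node $w'$ and edge $w'\to w$ for each $w\in I$; $S^I$ is $S$ with these edges added. An internal edge of $S^I$ is an edge of $S$ neither of whose endpoints is a leaf of $S^I$ (i.e. an edge joining the center to a leaf in $I$). For a DAG $\mathcal{D}$ on a finite set $V$ and $A\subseteq V$, $c_{\mathcal{D}}(A)=1$ if some $a\in A$ has every $b\in A\setminus\{a\}$ as a parent in $\mathcal{D}$, and $0$ otherwise. $\mathrm{CIM}_S^I=\mathrm{conv}\{c_{\mathcal{G}^I}:\mathcal{G}\text{ a DAG with skeleton }S\}$. For an edge $u-v$ of $S$, $\mathbb{1}_{v\leftarrow u}(x)=\sum_{A\subseteq V(S)\setminus\{u,v\},\ |A|\ge1}(-1)^{|A|+1}x_{A\cup\{u,v\}}$ if $v\notin I$, and $\mathbb{1}_{v\leftarrow u}(x)=x_{uvv'}$ if $v\in I$. -}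

module Defs where

open import Data.Nat as ℕ using (ℕ; zero; suc)
open import Data.Bool using (Bool; true; false; _∧_; _∨_; not; if_then_else_; T)
open import Data.Fin using (Fin; zero; suc; splitAt; _↑ˡ_; _↑ʳ_)
open import Data.Fin.Properties using () renaming (_≟_ to _≟F_)
open import Data.Fin.Subset using (Subset; inside; outside; ∣_∣)
open import Data.Vec using (Vec; []; _∷_; lookup; replicate; _++_; _[_]≔_)
open import Data.Sum using (_⊎_; inj₁; inj₂)
open import Data.Product using (Σ; ∃; _×_; _,_; proj₁; proj₂)
open import Data.List using (List; []; _∷_; map)
open import Data.List.Relation.Unary.All using (All)
open import Data.Rational as ℚ using (ℚ; 0ℚ; 1ℚ; _+_; _*_; -_; _≤_)
open import Relation.Binary.PropositionalEquality using (_≡_; _≢_)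
open import Relation.Nullary using (¬_; does)

anyF : ∀ {m} → (Fin m → Bool) → Bool
anyF {zero}  f = false
anyF {suc m} f = f zero ∨ anyF (λ j → f (suc j))

allF : ∀ {m} → (Fin m → Bool) → Bool
allF {zero}  f = true
allF {suc m} f = f zero ∧ allF (λ j → f (suc j))

sumFin : ∀ {k} → (Fin k → ℚ) → ℚ
sumFin {zero}  f = 0ℚ
sumFin {suc k} f = f zero + sumFin (λ j → f (suc j))

sumℚ : List ℚ → ℚ
sumℚ []       = 0ℚ
sumℚ (q ∷ qs) = q + sumℚ qs

sumSub : ∀ {m} → (Subset m → ℚ) → ℚ
sumSub {zero}  f = f []
sumSub {suc m} f = sumSub (λ B → f (inside ∷ B)) + sumSub (λ B → f (outside ∷ B))

-- sgn k = (-1)^(k+1)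
sgn : ℕ → ℚ
sgn zero    = - 1ℚ
sgn (suc k) = - sgn k

-- Directed graphs, acyclicity, the star graph S on Fin (suc n)
-- (center = zero, leaves = suc i for i : Fin n)

-- A directed graph on Fin m: E a b = true means an edge a → b.
data Path {m : ℕ} (E : Fin m → Fin m → Bool) : Fin m → Fin m → Set where
  step : ∀ {a b} → T (E a b) → Path E a b
  _∷ₚ_ : ∀ {a b c} → T (E a b) → Path E b c → Path E a c

Acyclic : ∀ {m} → (Fin m → Fin m → Bool) → Set
Acyclic E = ∀ a → ¬ Path E a a

StarAdj : ∀ {n} → Fin (suc n) → Fin (suc n) → Set
StarAdj a b = (a ≡ zero × b ≢ zero) ⊎ (b ≡ zero × a ≢ zero)

record DAG (n : ℕ) : Set where
  field
    G       : Fin (suc n) → Fin (suc n) → Bool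
    acyclic : Acyclic G
    skel⇒   : ∀ a b → T (G a b ∨ G b a) → StarAdj a b
    skel⇐   : ∀ a b → StarAdj a b → T (G a b ∨ G b a)

-- G^I on the node set Fin (suc n + n):
--   ctr = zero, leaf i = suc (i ↑ˡ n), prime i = suc (n ↑ʳ i)
-- (prime i, i.e. the node i', is a node of G^I only when i ∈ I)

N : ℕ → ℕ
N n = suc n ℕ.+ n

ctr : ∀ {n} → Fin (N n)
ctr = zero

leaf : ∀ {n} → Fin n → Fin (N n)
leaf {n} i = suc (i ↑ˡ n)

prime : ∀ {n} → Fin n → Fin (N n)
prime {n} i = suc (n ↑ʳ i)

edgeI : ∀ {n} → (Fin (suc n) → Fin (suc n) → Bool) → Subset n →
        Fin (suc n) ⊎ Fin n → Fin (suc n) ⊎ Fin n → Bool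
edgeI G I (inj₁ a) (inj₁ b) = G a b
edgeI G I (inj₂ i) (inj₁ b) = lookup I i ∧ does (b ≟F suc i)
edgeI G I (inj₁ a) (inj₂ j) = false
edgeI G I (inj₂ i) (inj₂ j) = false

GI : ∀ {n} → (Fin (suc n) → Fin (suc n) → Bool) → Subset n →
     Fin (N n) → Fin (N n) → Bool
GI {n} G I a b = edgeI G I (splitAt (suc n) a) (splitAt (suc n) b)

cD : ∀ {m} → (Fin m → Fin m → Bool) → Subset m → Bool
cD E A = anyF λ a → lookup A a ∧ allF λ b →
           not (lookup A b) ∨ does (b ≟F a) ∨ E b a

toℚ : Bool → ℚ
toℚ true  = 1ℚ
toℚ false = 0ℚ

-- Coordinates of CIM_S^I: subsets A of V(G^I) with |A| ≥ 2.
-- Points are functions Subset (N n) → ℚ; only coordinates satisfying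
-- IsCoord are meaningful (all notions below only look at those).

Point : ℕ → Set
Point n = Subset (N n) → ℚ

IsCoord : ∀ n → Subset n → Subset (N n) → Set
IsCoord n I A = (2 ℕ.≤ ∣ A ∣) × (∀ i → lookup A (prime i) ≡ true → lookup I i ≡ true)

cimset : ∀ {n} → Subset n → DAG n → Point n
cimset I D A = toℚ (cD (GI (DAG.G D) I) A)

CIM : ∀ n → Subset n → Point n → Set
CIM n I x = ∃ λ (L : List (ℚ × DAG n)) →
  All (λ p → 0ℚ ≤ proj₁ p) L ×
  sumℚ (map proj₁ L) ≡ 1ℚ ×
  (∀ A → IsCoord n I A →
     x A ≡ sumℚ (map (λ p → proj₁ p * cimset I (proj₂ p) A) L))

AffInd : ∀ n → Subset n → ∀ {k} → (Fin k → Point n) → Set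
AffInd n I {k} p = ∀ (μ : Fin k → ℚ) →
  sumFin μ ≡ 0ℚ →
  (∀ A → IsCoord n I A → sumFin (λ j → μ j * p j A) ≡ 0ℚ) →
  ∀ j → μ j ≡ 0ℚ

HasDim : ∀ n → Subset n → (Point n → Set) → ℕ → Set
HasDim n I X d =
  (∃ λ (p : Fin (suc d) → Point n) → (∀ j → X (p j)) × AffInd n I p) ×
  (∀ (p : Fin (suc (suc d)) → Point n) → (∀ j → X (p j)) → ¬ AffInd n I p)

-- The bidirected-edge inequality for the edge  u - v  with
-- u = center (∉ I) and v = leaf i (∈ I).

-- the set A ∪ {u,v} ⊆ V(G^I) for A ⊆ leaves of S (given as B : Subset n)
withCtrLeaf : ∀ {n} → Fin n → Subset n → Subset (N n)
withCtrLeaf {n} i B = inside ∷ ((B [ i ]≔ inside) ++ replicate n outside)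

uvv' : ∀ {n} → Fin n → Subset (N n)
uvv' {n} i = inside ∷ ((replicate n outside [ i ]≔ inside) ++ (replicate n outside [ i ]≔ inside))

-- 1_{v←u}(x) with v = leaf i ∈ I :  x_{u v v'}
ind-v←u : ∀ {n} → Fin n → Point n → ℚ
ind-v←u i x = x (uvv' i)

-- 1_{u←v}(x) with u = center ∉ I :
--   Σ_{A ⊆ V(S)∖{u,v}, |A| ≥ 1} (-1)^{|A|+1} x_{A ∪ {u,v}}
-- (V(S)∖{u,v} = the leaves of S other than leaf i)
ind-u←v : ∀ {n} → Fin n → Point n → ℚ
ind-u←v i x = sumSub λ B →
  if not (lookup B i) ∧ does (1 ℕ.≤? ∣ B ∣)
  then sgn ∣ B ∣ * x (withCtrLeaf i B)
  else 0ℚ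

bidirected : ∀ {n} → Fin n → Point n → ℚ
bidirected i x = ind-v←u i x + ind-u←v i x

Valid : ∀ n → Subset n → (Point n → ℚ) → Set
Valid n I f = ∀ x → CIM n I x → f x ≤ 1ℚ

Facet : ∀ n → Subset n → (Point n → ℚ) → Set
Facet n I f = Valid n I f ×
  ∃ λ d → HasDim n I (CIM n I) (suc d) ×
          HasDim n I (λ x → CIM n I x × f x ≡ 1ℚ) d

module Submission where

-- A DAG with skeleton S is an orientation of the star, determined by the set y of leaves whose
-- edge points into the centre u.  Its characteristic imset c_y is the same for every y on all
-- coordinates except two kinds: on x_{u ∪ C} with |C| ≥ 2 it is [C ⊆ y], and on x_{u v v'} with
-- v ∈ I it is 1 − [v ∈ y].  Calling C free when |C| ≥ 2 or C = {v} with v ∈ I, the polytope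
-- CIM_S^I therefore lies in an affine space of dimension m = #free sets, while the vertices c_∅ and
-- c_C (C free) are affinely independent because the zeta matrix [C ⊆ C′] of inclusion is
-- unitriangular; so dim CIM_S^I = m.  By inclusion–exclusion the bidirected-edge functional takes the
-- value 1 − [y = {i}] at c_y.  Hence it is at most 1 on CIM_S^I, its face contains the m affinely
-- independent vertices other than c_{i}, and c_{i} (where it vanishes) extends every affinely
-- independent family of the face, so the face has dimension m − 1.

open import Defs
open import Algebra.Bundles using (CommutativeRing; CommutativeMonoid)
open import Data.Bool using (Bool; true; false; _∧_; _∨_; not; T; if_then_else_)
import Data.Bool.Properties as Bool
open import Data.Empty using (⊥-elim)
open import Data.Fin using (Fin; zero; suc; punchIn; splitAt)
open import Data.Fin.Properties
  using (¬∀⟶∃¬; all?; any?; punchInᵢ≢i; splitAt-↑ˡ; splitAt-↑ʳ; join-splitAt; suc-injective; ↑ˡ-injective)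
  renaming (_≟_ to _≟F_)
open import Data.Fin.Subset using (Subset; inside; outside; ⊥; ⁅_⁆; _∈_; _⊆_; _⊂_; ∣_∣)
open import Data.Fin.Subset.Induction using (⊃-wellFounded)
open import Data.Fin.Subset.Properties
  using (_⊆?_; _∈?_; ⊆-refl; ⊆-antisym; ⊥⊆; ∉⊥; x∈⁅x⁆; x∈⁅y⁆⇒x≡y; nonempty?; Empty-unique;
         ∣⊥∣≡0; ∣⁅x⁆∣≡1; ∣p∣≤∣x∷p∣)
open import Data.List as List using (List; []; _∷_; map; filter; length)
open import Data.List.Membership.Propositional using () renaming (_∈_ to _∈ˡ_)
open import Data.List.Membership.Propositional.Properties
  using (∈-lookup; ∈-map⁺; ∈-map⁻; ∈-++⁺ˡ; ∈-++⁺ʳ; ∈-filter⁺)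
open import Data.List.Relation.Unary.All as All using (All; []; _∷_)
open import Data.List.Relation.Unary.All.Properties using (all-filter)
open import Data.List.Relation.Unary.AllPairs using ([]; _∷_)
open import Data.List.Relation.Unary.Any using (here; there; index)
open import Data.List.Relation.Unary.Any.Properties using (lookup-index)
open import Data.List.Relation.Unary.Unique.Propositional using (Unique)
import Data.List.Relation.Unary.Unique.Propositional.Properties as Unique
open import Data.Nat.Base as ℕ using (ℕ; zero; suc; _≤_; _<_; s≤s; z≤n)
import Data.Nat.Properties as ℕ
open import Data.Product using (∃; _×_; _,_; proj₁; proj₂)
open import Data.Rational as ℚ using (ℚ; 0ℚ; 1ℚ; _+_; _*_; -_; 1/_; ≢-nonZero; nonNegative)
open import Data.Rational.Properties
  using (_≟_; +-identityˡ; +-identityʳ; *-identityˡ; *-identityʳ; *-zeroˡ; *-zeroʳ; +-inverseˡ; +-inverseʳ;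
         *-inverseˡ; +-assoc; *-distribˡ-+; *-distribʳ-+; neg-distrib-+; neg-distribˡ-*; ≤-refl; ≤-trans;
         ≤-reflexive; ≤ᵇ⇒≤; +-mono-≤; *-monoˡ-≤-nonNeg; module ≤-Reasoning;
         +-0-commutativeMonoid; +-*-commutativeRing)
open import Data.Rational.Solver using (module +-*-Solver)
open import Data.Sum using (_⊎_; inj₁; inj₂)
open import Data.Vec as Vec using (Vec; []; _∷_; lookup; _++_; _[_]≔_; tabulate)
open import Data.Vec.Properties
  using (lookup-++ˡ; lookup-++ʳ; lookup-replicate; lookup∘tabulate; lookup∘update; lookup∘update′;
         []=⇒lookup; lookup⇒[]=; ∷-injectiveʳ; ≡-dec)
import Data.Vec.Functional as Vector
open import Data.Vec.Functional.Properties using (insertAt-lookup; insertAt-punchIn)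
open import Function using (_∘_)
import Induction.WellFounded as WF
open import Relation.Binary.PropositionalEquality
open import Relation.Nullary using (¬_; yes; no; does; Dec; contradiction; ¬?)
open import Relation.Nullary.Decidable
  using (dec-true; dec-false; decidable-stable; _→-dec_; _×-dec_; _⊎-dec_)

open import Algebra.Properties.CommutativeSemigroup
  (CommutativeMonoid.commutativeSemigroup +-0-commutativeMonoid) using (interchange)
open import Algebra.Properties.Semiring.Sum (CommutativeRing.semiring +-*-commutativeRing)
  using (sum; sum-cong-≗; ∑-distrib-+; *-distribˡ-sum; *-distribʳ-sum; sum-remove; sum-replicate-zero)
open +-*-Solver

sumFin≡sum : ∀ {k} (f : Fin k → ℚ) → sumFin f ≡ sum f
sumFin≡sum {zero}  f = refl
sumFin≡sum {suc k} f = cong (f zero +_) (sumFin≡sum (f ∘ suc))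

sumFin-cong : ∀ {k} {f g : Fin k → ℚ} → (∀ j → f j ≡ g j) → sumFin f ≡ sumFin g
sumFin-cong {f = f} {g} f≗g = trans (sumFin≡sum f) (trans (sum-cong-≗ f≗g) (sym (sumFin≡sum g)))

sum-zero : ∀ {k} (f : Fin k → ℚ) → (∀ j → f j ≡ 0ℚ) → sum f ≡ 0ℚ
sum-zero {k} f f≡0 = trans (sum-cong-≗ f≡0) (sum-replicate-zero k)

sum-single : ∀ {k} (f : Fin k → ℚ) j → (∀ j′ → j′ ≢ j → f j′ ≡ 0ℚ) → sum f ≡ f j
sum-single {suc k} f j off = begin
  sum f                          ≡⟨ sum-remove {i = j} f ⟩
  f j + sum (Vector.removeAt f j) ≡⟨ cong (f j +_) (sum-zero _ (λ j′ → off _ (punchInᵢ≢i j j′))) ⟩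
  f j + 0ℚ                       ≡⟨ +-identityʳ (f j) ⟩
  f j                            ∎
  where open ≡-Reasoning

sum-insertAt : ∀ {k} (ν : Fin k → ℚ) j₀ t (g : Fin (suc k) → ℚ) →
  sum (λ j → Vector.insertAt ν j₀ t j * g j) ≡ t * g j₀ + sum (λ j′ → ν j′ * g (punchIn j₀ j′))
sum-insertAt ν j₀ t g = begin
  sum (λ j → μ j * g j)
    ≡⟨ sum-remove {i = j₀} (λ j → μ j * g j) ⟩
  μ j₀ * g j₀ + sum (λ j′ → μ (punchIn j₀ j′) * g (punchIn j₀ j′))
    ≡⟨ cong₂ _+_ (cong (_* g j₀) (insertAt-lookup ν j₀ t))
                 (sum-cong-≗ (λ j′ → cong (_* g (punchIn j₀ j′)) (insertAt-punchIn ν j₀ t j′))) ⟩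
  t * g j₀ + sum (λ j′ → ν j′ * g (punchIn j₀ j′))
    ∎
  where
  open ≡-Reasoning
  μ = Vector.insertAt ν j₀ t

sumSub-cong : ∀ {m} {f g : Subset m → ℚ} → (∀ B → f B ≡ g B) → sumSub f ≡ sumSub g
sumSub-cong {zero}  f≗g = f≗g []
sumSub-cong {suc m} f≗g = cong₂ _+_ (sumSub-cong (f≗g ∘ (inside ∷_))) (sumSub-cong (f≗g ∘ (outside ∷_)))

sumSub-distrib-+ : ∀ {m} (f g : Subset m → ℚ) → sumSub (λ B → f B + g B) ≡ sumSub f + sumSub g
sumSub-distrib-+ {zero}  f g = refl
sumSub-distrib-+ {suc m} f g =
  trans (cong₂ _+_ (sumSub-distrib-+ (f ∘ (inside ∷_)) (g ∘ (inside ∷_)))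
                   (sumSub-distrib-+ (f ∘ (outside ∷_)) (g ∘ (outside ∷_))))
        (interchange (sumSub (f ∘ (inside ∷_))) (sumSub (g ∘ (inside ∷_)))
                     (sumSub (f ∘ (outside ∷_))) (sumSub (g ∘ (outside ∷_))))

*-distribˡ-sumSub : ∀ {m} c (f : Subset m → ℚ) → sumSub (λ B → c * f B) ≡ c * sumSub f
*-distribˡ-sumSub {zero}  c f = refl
*-distribˡ-sumSub {suc m} c f =
  trans (cong₂ _+_ (*-distribˡ-sumSub c (f ∘ (inside ∷_))) (*-distribˡ-sumSub c (f ∘ (outside ∷_))))
        (sym (*-distribˡ-+ c _ _))

sumSub-neg : ∀ {m} (f : Subset m → ℚ) → sumSub (λ B → - f B) ≡ - sumSub f
sumSub-neg {zero}  f = refl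
sumSub-neg {suc m} f =
  trans (cong₂ _+_ (sumSub-neg (f ∘ (inside ∷_))) (sumSub-neg (f ∘ (outside ∷_))))
        (sym (neg-distrib-+ (sumSub (f ∘ (inside ∷_))) (sumSub (f ∘ (outside ∷_)))))

sumSub-zero : ∀ {m} (f : Subset m → ℚ) → (∀ B → f B ≡ 0ℚ) → sumSub f ≡ 0ℚ
sumSub-zero {zero}  f f≡0 = f≡0 []
sumSub-zero {suc m} f f≡0 =
  trans (cong₂ _+_ (sumSub-zero _ (f≡0 ∘ (inside ∷_))) (sumSub-zero _ (f≡0 ∘ (outside ∷_)))) (+-identityʳ 0ℚ)

sumSub-nonempty : ∀ {m} (g : Subset m → ℚ) →
  sumSub (λ B → if does (1 ℕ.≤? ∣ B ∣) then g B else 0ℚ) ≡ sumSub g + - g ⊥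
sumSub-nonempty {zero}  g = sym (+-inverseʳ (g []))
sumSub-nonempty {suc m} g =
  trans (cong (sumSub (g ∘ (inside ∷_)) +_) (sumSub-nonempty (g ∘ (outside ∷_))))
        (sym (+-assoc (sumSub (g ∘ (inside ∷_))) (sumSub (g ∘ (outside ∷_))) (- g ⊥)))

NontrivialSolution : ∀ {m k} → (Fin m → Fin k → ℚ) → Set
NontrivialSolution {k = k} a =
  ∃ λ (μ : Fin k → ℚ) → (∀ r → sum (λ j → μ j * a r j) ≡ 0ℚ) × ∃ λ j → μ j ≢ 0ℚ

homogeneous-nontrivial : ∀ {m k} → m < k → (a : Fin m → Fin k → ℚ) → NontrivialSolution a
homogeneous-nontrivial {zero}  {suc k} _ a = (λ _ → 1ℚ) , (λ ()) , zero , λ ()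
homogeneous-nontrivial {suc m} {suc k} (s≤s m<k) a with all? (λ j → a zero j ≟ 0ℚ)
... | yes row₀≡0 =
  let μ , solves , nontrivial = homogeneous-nontrivial (ℕ.m<n⇒m<1+n m<k) (a ∘ suc)
  in μ , (λ { zero    → sum-zero _ (λ j → trans (cong (μ j *_) (row₀≡0 j)) (*-zeroʳ (μ j)))
            ; (suc r) → solves r })
       , nontrivial
... | no row₀≢0 with ¬∀⟶∃¬ _ _ (λ j → a zero j ≟ 0ℚ) row₀≢0
...   | j₀ , p≢0 = μ , solves , punchIn j₀ j₁ , ν≢0 ∘ trans (sym (insertAt-punchIn ν j₀ t j₁))
  where
  instance _ = ≢-nonZero p≢0
  p = a zero j₀
  reduced : Fin m → Fin k → ℚ
  reduced r j′ = a (suc r) (punchIn j₀ j′) + - (a (suc r) j₀ * (a zero (punchIn j₀ j′) * 1/ p))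
  IH = homogeneous-nontrivial m<k reduced
  ν = proj₁ IH
  j₁ = proj₁ (proj₂ (proj₂ IH))
  ν≢0 = proj₂ (proj₂ (proj₂ IH))
  S = sum (λ j′ → ν j′ * a zero (punchIn j₀ j′))
  t = - (S * 1/ p)
  μ = Vector.insertAt ν j₀ t
  solves : ∀ r → sum (λ j → μ j * a r j) ≡ 0ℚ
  solves zero = begin
    sum (λ j → μ j * a zero j) ≡⟨ sum-insertAt ν j₀ t (a zero) ⟩
    t * p + S                  ≡⟨ solve 3 (λ S q p → :- (S :* q) :* p :+ S := S :+ :- (S :* (q :* p))) refl S (1/ p) p ⟩
    S + - (S * (1/ p * p))     ≡⟨ cong (λ z → S + - (S * z)) (*-inverseˡ p) ⟩
    S + - (S * 1ℚ)             ≡⟨ cong (λ z → S + - z) (*-identityʳ S) ⟩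
    S + - S                    ≡⟨ +-inverseʳ S ⟩
    0ℚ                         ∎
    where open ≡-Reasoning
  solves (suc r) = begin
    sum (λ j → μ j * g j)                   ≡⟨ sum-insertAt ν j₀ t g ⟩
    t * g₀ + P
      ≡⟨ solve 4 (λ S q g₀ P → :- (S :* q) :* g₀ :+ P := P :+ (:- (g₀ :* q)) :* S) refl S (1/ p) g₀ P ⟩
    P + c * S                               ≡⟨ cong (P +_) (*-distribˡ-sum c (λ j′ → ν j′ * a zero (punchIn j₀ j′))) ⟩
    P + sum (λ j′ → c * (ν j′ * a zero (punchIn j₀ j′)))
      ≡⟨ ∑-distrib-+ (λ j′ → ν j′ * g (punchIn j₀ j′)) _ ⟨
    sum (λ j′ → ν j′ * g (punchIn j₀ j′) + c * (ν j′ * a zero (punchIn j₀ j′)))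
      ≡⟨ sum-cong-≗ (λ j′ → solve 5 (λ ν x g₀ y q → ν :* (x :+ :- (g₀ :* (y :* q)))
                                                 := ν :* x :+ (:- (g₀ :* q)) :* (ν :* y))
                                   refl (ν j′) (g (punchIn j₀ j′)) g₀ (a zero (punchIn j₀ j′)) (1/ p)) ⟨
    sum (λ j′ → ν j′ * reduced r j′)        ≡⟨ proj₁ (proj₂ IH) r ⟩
    0ℚ                                      ∎
    where
    open ≡-Reasoning
    g = a (suc r)
    g₀ = g j₀
    c = - (g₀ * 1/ p)
    P = sum (λ j′ → ν j′ * g (punchIn j₀ j′))

ζ : ∀ {m} → Subset m → Subset m → ℚ
ζ p q = toℚ (does (p ⊆? q))

⊆∧≢⇒⊂ : ∀ {m} {p q : Subset m} → p ⊆ q → p ≢ q → p ⊂ q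
⊆∧≢⇒⊂ {p = p} {q} p⊆q p≢q
  with ¬∀⟶∃¬ _ (λ x → x ∈ q → x ∈ p) (λ x → x ∈? q →-dec x ∈? p)
                (λ q⊆p → p≢q (⊆-antisym p⊆q (q⊆p _)))
... | x , x∈q⇏x∈p with x ∈? q
...   | yes x∈q = p⊆q , x , x∈q , λ x∈p → x∈q⇏x∈p (λ _ → x∈p)
...   | no  x∉q = contradiction (λ x∈q → contradiction x∈q x∉q) x∈q⇏x∈p

ζ-unitriangular : ∀ {m k} (B : Fin k → Subset m) → (∀ {r r′} → B r ≡ B r′ → r ≡ r′) →
  (μ : Fin k → ℚ) → (∀ r → sum (λ r′ → μ r′ * ζ (B r) (B r′)) ≡ 0ℚ) → ∀ r → μ r ≡ 0ℚ
ζ-unitriangular {m} {k} B B-injective μ rows r = WF.All.wfRec ⊃-wellFounded _ Vanishes induct (B r) r refl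
  where
  Vanishes : Subset m → Set
  Vanishes C = ∀ r → B r ≡ C → μ r ≡ 0ℚ
  induct : ∀ C → (∀ {C′} → C ⊂ C′ → Vanishes C′) → Vanishes C
  induct _ IH r refl = begin
    μ r                                 ≡⟨ *-identityʳ (μ r) ⟨
    μ r * 1ℚ                            ≡⟨ cong (λ b → μ r * toℚ b) (dec-true (B r ⊆? B r) ⊆-refl) ⟨
    μ r * ζ (B r) (B r)                 ≡⟨ sum-single (λ r′ → μ r′ * ζ (B r) (B r′)) r above ⟨
    sum (λ r′ → μ r′ * ζ (B r) (B r′))  ≡⟨ rows r ⟩
    0ℚ                                  ∎
    where
    open ≡-Reasoning
    above : ∀ r′ → r′ ≢ r → μ r′ * ζ (B r) (B r′) ≡ 0ℚ
    above r′ r′≢r with B r ⊆? B r′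
    ... | no  _      = *-zeroʳ (μ r′)
    ... | yes Br⊆Br′ =
      trans (cong (_* 1ℚ) (IH (⊆∧≢⇒⊂ Br⊆Br′ (r′≢r ∘ sym ∘ B-injective)) r′ refl)) (*-zeroˡ 1ℚ)

sumSub-sgn-ζ : ∀ {m} (K : Subset m) k → sumSub (λ B → sgn (∣ B ∣ ℕ.+ k) * ζ B K) ≡ sgn k * ζ K ⊥
sumSub-sgn-ζ []          k = refl
sumSub-sgn-ζ (true  ∷ K) k = begin
  sumSub (λ B → - sgn (∣ B ∣ ℕ.+ k) * ζ B K) + S
    ≡⟨ cong (_+ S) (sumSub-cong (λ B → sym (neg-distribˡ-* (sgn (∣ B ∣ ℕ.+ k)) (ζ B K)))) ⟩
  sumSub (λ B → - (sgn (∣ B ∣ ℕ.+ k) * ζ B K)) + S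
    ≡⟨ cong (_+ S) (sumSub-neg (λ B → sgn (∣ B ∣ ℕ.+ k) * ζ B K)) ⟩
  - S + S
    ≡⟨ +-inverseˡ S ⟩
  0ℚ
    ≡⟨ *-zeroʳ (sgn k) ⟨
  sgn k * 0ℚ
    ∎
  where
  open ≡-Reasoning
  S = sumSub (λ B → sgn (∣ B ∣ ℕ.+ k) * ζ B K)
sumSub-sgn-ζ {suc m} (false ∷ K) k = begin
  sumSub (λ B → sgn (suc (∣ B ∣ ℕ.+ k)) * ζ (inside ∷ B) (outside ∷ K)) + S
    ≡⟨ cong (_+ S) (sumSub-zero {m} _ (λ B → *-zeroʳ (sgn (suc (∣ B ∣ ℕ.+ k))))) ⟩
  0ℚ + S
    ≡⟨ +-identityˡ S ⟩
  S
    ≡⟨ sumSub-sgn-ζ K k ⟩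
  sgn k * ζ K ⊥
    ∎
  where
  open ≡-Reasoning
  S = sumSub (λ B → sgn (∣ B ∣ ℕ.+ k) * ζ B K)

true≢false : true ≢ false
true≢false ()

≡-by-true : ∀ {a b : Bool} → (a ≡ true → b ≡ true) → (b ≡ true → a ≡ true) → a ≡ b
≡-by-true {false} {false} _   _   = refl
≡-by-true {false} {true}  _   b⇒a = b⇒a refl
≡-by-true {true}  {false} a⇒b _   = sym (a⇒b refl)
≡-by-true {true}  {true}  _   _   = refl

witness : ∀ {a} {A : Set a} (a? : Dec A) → does a? ≡ true → A
witness (yes a) _ = a

lookup-⊥ : ∀ {m} (j : Fin m) → lookup (⊥ {m}) j ≡ false
lookup-⊥ j = lookup-replicate j outside

lookup-⁅x⁆ : ∀ {m} (j : Fin m) → lookup ⁅ j ⁆ j ≡ true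
lookup-⁅x⁆ j = []=⇒lookup (x∈⁅x⁆ j)

lookup-⁅y⁆⇒≡ : ∀ {m} (j k : Fin m) → lookup ⁅ j ⁆ k ≡ true → k ≡ j
lookup-⁅y⁆⇒≡ j k k∈⁅j⁆ = x∈⁅y⁆⇒x≡y j (lookup⇒[]= k ⁅ j ⁆ k∈⁅j⁆)

sole-member⇒≡⁅⁆ : ∀ {m} {p : Subset m} {j} →
  lookup p j ≡ true → (∀ k → lookup p k ≡ true → k ≡ j) → p ≡ ⁅ j ⁆
sole-member⇒≡⁅⁆ {p = p} {j} j∈p sole = ⊆-antisym
  (λ {k} k∈p → subst (_∈ ⁅ j ⁆) (sym (sole k ([]=⇒lookup k∈p))) (x∈⁅x⁆ j))
  (λ {k} k∈⁅j⁆ → lookup⇒[]= k p (subst (λ z → lookup p z ≡ true) (sym (x∈⁅y⁆⇒x≡y j k∈⁅j⁆)) j∈p))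

⊥[j]≔inside≡⁅j⁆ : ∀ {m} (j : Fin m) → ⊥ [ j ]≔ inside ≡ ⁅ j ⁆
⊥[j]≔inside≡⁅j⁆ zero    = refl
⊥[j]≔inside≡⁅j⁆ (suc j) = cong (outside ∷_) (⊥[j]≔inside≡⁅j⁆ j)

⁅i⁆[i]≔outside≡⊥ : ∀ {m} (i : Fin m) → ⁅ i ⁆ [ i ]≔ outside ≡ ⊥
⁅i⁆[i]≔outside≡⊥ zero    = refl
⁅i⁆[i]≔outside≡⊥ (suc i) = cong (outside ∷_) (⁅i⁆[i]≔outside≡⊥ i)

∣++∣ : ∀ {m k} (L : Subset m) (P : Subset k) → ∣ L ++ P ∣ ≡ ∣ L ∣ ℕ.+ ∣ P ∣
∣++∣ []          P = refl
∣++∣ (true  ∷ L) P = cong suc (∣++∣ L P)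
∣++∣ (false ∷ L) P = ∣++∣ L P

∣L++⊥∣ : ∀ {m k} (L : Subset m) → ∣ L ++ ⊥ {k} ∣ ≡ ∣ L ∣
∣L++⊥∣ {k = k} L = trans (∣++∣ L ⊥) (trans (cong (∣ L ∣ ℕ.+_) (∣⊥∣≡0 k)) (ℕ.+-identityʳ ∣ L ∣))

∣[]≔inside∣ : ∀ {m} (B : Subset m) i → lookup B i ≡ false → ∣ B [ i ]≔ inside ∣ ≡ suc ∣ B ∣
∣[]≔inside∣ (false ∷ B) zero    _   = refl
∣[]≔inside∣ (true  ∷ B) (suc i) i∉B = cong suc (∣[]≔inside∣ B i i∉B)
∣[]≔inside∣ (false ∷ B) (suc i) i∉B = ∣[]≔inside∣ B i i∉B

member⇒1≤∣∣ : ∀ {m} (C : Subset m) {j} → lookup C j ≡ true → 1 ≤ ∣ C ∣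
member⇒1≤∣∣ (true ∷ C) {zero}  _   = s≤s z≤n
member⇒1≤∣∣ (c    ∷ C) {suc j} j∈C = ℕ.≤-trans (member⇒1≤∣∣ C j∈C) (∣p∣≤∣x∷p∣ c C)

two-members⇒2≤∣∣ : ∀ {m} (C : Subset m) {j k} → lookup C j ≡ true → lookup C k ≡ true → j ≢ k → 2 ≤ ∣ C ∣
two-members⇒2≤∣∣ (c    ∷ C) {zero}  {zero}  _   _   j≢k = contradiction refl j≢k
two-members⇒2≤∣∣ (true ∷ C) {zero}  {suc k} _   k∈C _   = s≤s (member⇒1≤∣∣ C k∈C)
two-members⇒2≤∣∣ (true ∷ C) {suc j} {zero}  j∈C _   _   = s≤s (member⇒1≤∣∣ C j∈C)
two-members⇒2≤∣∣ (c    ∷ C) {suc j} {suc k} j∈C k∈C j≢k =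
  ℕ.≤-trans (two-members⇒2≤∣∣ C j∈C k∈C (j≢k ∘ cong suc)) (∣p∣≤∣x∷p∣ c C)

some-member : ∀ {m} (C : Subset m) → 1 ≤ ∣ C ∣ → ∃ λ k → lookup C k ≡ true
some-member (true  ∷ C) _      = zero , refl
some-member (false ∷ C) 1≤∣C∣ = let k , k∈C = some-member C 1≤∣C∣ in suc k , k∈C

another-member : ∀ {m} (C : Subset m) → 2 ≤ ∣ C ∣ → ∀ j → ∃ λ k → k ≢ j × lookup C k ≡ true
another-member (true  ∷ C) (s≤s 1≤∣C∣) zero =
  let k , k∈C = some-member C 1≤∣C∣ in suc k , (λ ()) , k∈C
another-member (false ∷ C) 2≤∣C∣ zero =
  let k , k∈C = some-member C (ℕ.≤-trans (ℕ.n≤1+n 1) 2≤∣C∣) in suc k , (λ ()) , k∈C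
another-member (true  ∷ C) _     (suc j) = zero , (λ ()) , refl
another-member (false ∷ C) 2≤∣C∣ (suc j) =
  let k , k≢j , k∈C = another-member C 2≤∣C∣ j in suc k , k≢j ∘ suc-injective , k∈C

⁅j⁆⊆?-does : ∀ {m} (j : Fin m) (y : Subset m) → does (⁅ j ⁆ ⊆? y) ≡ lookup y j
⁅j⁆⊆?-does zero    (true  ∷ y) = dec-true (⊥ ⊆? y) ⊥⊆
⁅j⁆⊆?-does zero    (false ∷ y) = refl
⁅j⁆⊆?-does (suc j) (_     ∷ y) = ⁅j⁆⊆?-does j y

⊆?-[]≔inside : ∀ {m} (B y : Subset m) i → lookup B i ≡ false →
  does ((B [ i ]≔ inside) ⊆? y) ≡ lookup y i ∧ does (B ⊆? (y [ i ]≔ outside))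
⊆?-[]≔inside (false ∷ B) (true  ∷ y) zero    _   = refl
⊆?-[]≔inside (false ∷ B) (false ∷ y) zero    _   = refl
⊆?-[]≔inside (false ∷ B) (_     ∷ y) (suc i) i∉B = ⊆?-[]≔inside B y i i∉B
⊆?-[]≔inside (true  ∷ B) (true  ∷ y) (suc i) i∉B = ⊆?-[]≔inside B y i i∉B
⊆?-[]≔inside (true  ∷ B) (false ∷ y) (suc i) _   = sym (Bool.∧-zeroʳ (lookup y i))

⊆?-[]≔outside : ∀ {m} (B y : Subset m) i → lookup B i ≡ true → does (B ⊆? (y [ i ]≔ outside)) ≡ false
⊆?-[]≔outside B y i i∈B = dec-false (B ⊆? (y [ i ]≔ outside)) λ B⊆y-i →
  true≢false (trans (sym ([]=⇒lookup (B⊆y-i (lookup⇒[]= i B i∈B)))) (lookup∘update i y outside))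

module _ {n} (I : Subset n) where

  AgreeOnCoords : Point n → Point n → Set
  AgreeOnCoords x y = ∀ A → IsCoord n I A → x A ≡ y A

  record Linear (f : Point n → ℚ) : Set where
    field
      local       : ∀ {x y} → AgreeOnCoords x y → f x ≡ f y
      additive    : ∀ x y → f (λ A → x A + y A) ≡ f x + f y
      homogeneous : ∀ c x → f (λ A → c * x A) ≡ c * f x

  open Linear

  linear-eval : ∀ A → IsCoord n I A → Linear (λ x → x A)
  linear-eval A A-coord = record
    { local = λ x≈y → x≈y A A-coord ; additive = λ _ _ → refl ; homogeneous = λ _ _ → refl }

  linear-0 : Linear (λ _ → 0ℚ)
  linear-0 = record
    { local = λ _ → refl ; additive = λ _ _ → sym (+-identityʳ 0ℚ) ; homogeneous = λ c _ → sym (*-zeroʳ c) }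

  linear-scale : ∀ {f} c → Linear f → Linear (λ x → c * f x)
  linear-scale {f} c lin = record
    { local       = cong (c *_) ∘ local lin
    ; additive    = λ x y → trans (cong (c *_) (additive lin x y)) (*-distribˡ-+ c (f x) (f y))
    ; homogeneous = λ d x → trans (cong (c *_) (homogeneous lin d x))
                                  (solve 3 (λ c d z → c :* (d :* z) := d :* (c :* z)) refl c d (f x))
    }

  linear-+ : ∀ {f g} → Linear f → Linear g → Linear (λ x → f x + g x)
  linear-+ {f} {g} lf lg = record
    { local       = λ x≈y → cong₂ _+_ (local lf x≈y) (local lg x≈y)
    ; additive    = λ x y → trans (cong₂ _+_ (additive lf x y) (additive lg x y)) (interchange (f x) (f y) (g x) (g y))
    ; homogeneous = λ c x → trans (cong₂ _+_ (homogeneous lf c x) (homogeneous lg c x))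
                                  (sym (*-distribˡ-+ c (f x) (g x)))
    }

  linear-sumSub : ∀ {m} {g : Subset m → Point n → ℚ} → (∀ B → Linear (g B)) →
    Linear (λ x → sumSub (λ B → g B x))
  linear-sumSub {g = g} lg = record
    { local       = λ x≈y → sumSub-cong (λ B → local (lg B) x≈y)
    ; additive    = λ x y → trans (sumSub-cong (λ B → additive (lg B) x y)) (sumSub-distrib-+ (λ B → g B x) (λ B → g B y))
    ; homogeneous = λ c x → trans (sumSub-cong (λ B → homogeneous (lg B) c x)) (*-distribˡ-sumSub c (λ B → g B x))
    }

  module _ {f} (lin : Linear f) where

    linear-zero : f (λ _ → 0ℚ) ≡ 0ℚ
    linear-zero = trans (homogeneous lin 0ℚ (λ _ → 0ℚ)) (*-zeroˡ (f (λ _ → 0ℚ)))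

    linear-sumFin : ∀ {k} (μ : Fin k → ℚ) (p : Fin k → Point n) →
      f (λ A → sumFin (λ j → μ j * p j A)) ≡ sumFin (λ j → μ j * f (p j))
    linear-sumFin {zero}  μ p = linear-zero
    linear-sumFin {suc k} μ p = trans (additive lin _ _)
      (cong₂ _+_ (homogeneous lin (μ zero) (p zero)) (linear-sumFin (μ ∘ suc) (p ∘ suc)))

    linear-convex : (L : List (ℚ × DAG n)) →
      f (λ A → sumℚ (map (λ w → proj₁ w * cimset I (proj₂ w) A) L)) ≡
      sumℚ (map (λ w → proj₁ w * f (cimset I (proj₂ w))) L)
    linear-convex []      = linear-zero
    linear-convex (w ∷ L) = trans (additive lin _ _)
      (cong₂ _+_ (homogeneous lin (proj₁ w) (cimset I (proj₂ w))) (linear-convex L))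

    valid-on-vertices⇒valid : (∀ D → f (cimset I D) ℚ.≤ 1ℚ) → Valid n I f
    valid-on-vertices⇒valid f≤1 x (L , w≥0 , ∑w≡1 , x≡∑) = begin
      f x                                                           ≡⟨ local lin x≡∑ ⟩
      f (λ A → sumℚ (map (λ w → proj₁ w * cimset I (proj₂ w) A) L)) ≡⟨ linear-convex L ⟩
      sumℚ (map (λ w → proj₁ w * f (cimset I (proj₂ w))) L)         ≤⟨ weighted≤ L w≥0 ⟩
      sumℚ (map proj₁ L)                                            ≡⟨ ∑w≡1 ⟩
      1ℚ                                                            ∎
      where
      open ≤-Reasoning
      weighted≤ : ∀ L → All (λ w → 0ℚ ℚ.≤ proj₁ w) L →
        sumℚ (map (λ w → proj₁ w * f (cimset I (proj₂ w))) L) ℚ.≤ sumℚ (map proj₁ L)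
      weighted≤ []      []          = ≤-refl
      weighted≤ (w ∷ L) (w≥0 ∷ L≥0) = +-mono-≤
        (≤-trans (*-monoˡ-≤-nonNeg (proj₁ w) {{nonNegative w≥0}} (f≤1 (proj₂ w)))
                 (≤-reflexive (*-identityʳ (proj₁ w))))
        (weighted≤ L L≥0)

    AffInd-∷ : ∀ {k} (q : Point n) (p : Fin k → Point n) →
      f q ≡ 0ℚ → (∀ j → f (p j) ≡ 1ℚ) → AffInd n I p → AffInd n I (q Vector.∷ p)
    AffInd-∷ q p fq≡0 fp≡1 affInd μ ∑μ≡0 combination≡0 = λ { zero → μ₀≡0 ; (suc j) → tail≡0 j }
      where
      open ≡-Reasoning
      ∑tail≡0 : sumFin (μ ∘ suc) ≡ 0ℚ
      ∑tail≡0 = begin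
        sumFin (μ ∘ suc)
          ≡⟨ sumFin-cong (λ j → trans (cong (μ (suc j) *_) (fp≡1 j)) (*-identityʳ (μ (suc j)))) ⟨
        sumFin (λ j → μ (suc j) * f (p j))
          ≡⟨ +-identityˡ _ ⟨
        0ℚ + sumFin (λ j → μ (suc j) * f (p j))
          ≡⟨ cong (_+ sumFin (λ j → μ (suc j) * f (p j))) (trans (cong (μ zero *_) fq≡0) (*-zeroʳ (μ zero))) ⟨
        sumFin (λ j → μ j * f ((q Vector.∷ p) j))
          ≡⟨ linear-sumFin μ (q Vector.∷ p) ⟨
        f (λ A → sumFin (λ j → μ j * (q Vector.∷ p) j A))
          ≡⟨ local lin combination≡0 ⟩
        f (λ _ → 0ℚ)
          ≡⟨ linear-zero ⟩
        0ℚ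
          ∎
      μ₀≡0 : μ zero ≡ 0ℚ
      μ₀≡0 = trans (sym (+-identityʳ (μ zero))) (trans (cong (μ zero +_) (sym ∑tail≡0)) ∑μ≡0)
      tail≡0 : ∀ j → μ (suc j) ≡ 0ℚ
      tail≡0 = affInd (μ ∘ suc) ∑tail≡0 λ A A-coord → begin
        sumFin (λ j → μ (suc j) * p j A)
          ≡⟨ +-identityˡ _ ⟨
        0ℚ + sumFin (λ j → μ (suc j) * p j A)
          ≡⟨ cong (_+ sumFin (λ j → μ (suc j) * p j A)) (trans (cong (_* q A) μ₀≡0) (*-zeroˡ (q A))) ⟨
        sumFin (λ j → μ j * (q Vector.∷ p) j A)
          ≡⟨ combination≡0 A A-coord ⟩
        0ℚ
          ∎

  CIM-constant-coordinate : ∀ {x A κ} → (∀ D → cimset I D A ≡ κ) → CIM n I x → IsCoord n I A → x A ≡ κ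
  CIM-constant-coordinate {x} {A} {κ} constant (L , _ , ∑w≡1 , x≡∑) A-coord = begin
    x A                                                   ≡⟨ x≡∑ A A-coord ⟩
    sumℚ (map (λ w → proj₁ w * cimset I (proj₂ w) A) L)   ≡⟨ weighted L ⟩
    sumℚ (map proj₁ L) * κ                                ≡⟨ cong (_* κ) ∑w≡1 ⟩
    1ℚ * κ                                                ≡⟨ *-identityˡ κ ⟩
    κ                                                     ∎
    where
    open ≡-Reasoning
    weighted : ∀ L → sumℚ (map (λ w → proj₁ w * cimset I (proj₂ w) A) L) ≡ sumℚ (map proj₁ L) * κ
    weighted []      = sym (*-zeroˡ κ)
    weighted (w ∷ L) = trans (cong₂ _+_ (cong (proj₁ w *_) (constant (proj₂ w))) (weighted L))
                             (sym (*-distribʳ-+ κ (proj₁ w) (sumℚ (map proj₁ L))))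

  ¬AffInd-few-free-coordinates : ∀ {m} (X : Point n → Set) (free : Fin m → Subset (N n)) →
    (∀ A → IsCoord n I A → (∃ λ r → A ≡ free r) ⊎ (∃ λ κ → ∀ x → X x → x A ≡ κ)) →
    (p : Fin (suc (suc m)) → Point n) → (∀ j → X (p j)) → ¬ AffInd n I p
  ¬AffInd-few-free-coordinates {m} X free classify p p∈X affInd =
    μj≢0 (affInd μ ∑μ≡0 (λ A A-coord → trans (sumFin≡sum (λ j → μ j * p j A)) (combination≡0 A A-coord)) j)
    where
    equations : Fin (suc m) → Fin (suc (suc m)) → ℚ
    equations zero    _ = 1ℚ
    equations (suc r) j = p j (free r)
    solution = homogeneous-nontrivial (ℕ.n<1+n (suc m)) equations
    μ = proj₁ solution
    solves = proj₁ (proj₂ solution)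
    j = proj₁ (proj₂ (proj₂ solution))
    μj≢0 = proj₂ (proj₂ (proj₂ solution))
    ∑μ≡0 : sumFin μ ≡ 0ℚ
    ∑μ≡0 = trans (sumFin≡sum μ) (trans (sum-cong-≗ (λ j → sym (*-identityʳ (μ j)))) (solves zero))
    combination≡0 : ∀ A → IsCoord n I A → sum (λ j → μ j * p j A) ≡ 0ℚ
    combination≡0 A A-coord with classify A A-coord
    ... | inj₁ (r , refl) = solves (suc r)
    ... | inj₂ (κ , x≡κ)  = begin
      sum (λ j → μ j * p j A)  ≡⟨ sum-cong-≗ (λ j → cong (μ j *_) (x≡κ (p j) (p∈X j))) ⟩
      sum (λ j → μ j * κ)      ≡⟨ *-distribʳ-sum κ μ ⟨
      sum μ * κ                ≡⟨ cong (_* κ) (trans (sym (sumFin≡sum μ)) ∑μ≡0) ⟩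
      0ℚ * κ                   ≡⟨ *-zeroˡ κ ⟩
      0ℚ                       ∎
      where open ≡-Reasoning

-- Characteristic imsets through sinks

anyF⇒∃ : ∀ {m} (f : Fin m → Bool) → anyF f ≡ true → ∃ λ j → f j ≡ true
anyF⇒∃ {suc m} f p with f zero in f₀
... | true  = zero , f₀
... | false = let j , fj = anyF⇒∃ (f ∘ suc) p in suc j , fj

∃⇒anyF : ∀ {m} (f : Fin m → Bool) j → f j ≡ true → anyF f ≡ true
∃⇒anyF f zero    fj rewrite fj = refl
∃⇒anyF f (suc j) fj rewrite ∃⇒anyF (f ∘ suc) j fj = Bool.∨-zeroʳ (f zero)

allF⇒∀ : ∀ {m} (f : Fin m → Bool) → allF f ≡ true → ∀ j → f j ≡ true
allF⇒∀ f p zero    = Bool.∧-conicalˡ (f zero) _ p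
allF⇒∀ f p (suc j) = allF⇒∀ (f ∘ suc) (Bool.∧-conicalʳ (f zero) _ p) j

∀⇒allF : ∀ {m} (f : Fin m → Bool) → (∀ j → f j ≡ true) → allF f ≡ true
∀⇒allF {zero}  f _ = refl
∀⇒allF {suc m} f h rewrite h zero = ∀⇒allF (f ∘ suc) (h ∘ suc)

module _ {m} (E : Fin m → Fin m → Bool) (A : Subset m) where

  IsSink : Fin m → Set
  IsSink a = lookup A a ≡ true × (∀ b → lookup A b ≡ true → b ≢ a → E b a ≡ true)

  private
    sinkCondition : Fin m → Fin m → Bool
    sinkCondition a b = not (lookup A b) ∨ does (b ≟F a) ∨ E b a

  cD⇒sink : cD E A ≡ true → ∃ IsSink
  cD⇒sink p with anyF⇒∃ _ p
  ... | a , q = a , Bool.∧-conicalˡ _ _ q , λ b b∈A b≢a → edge b b∈A b≢a (allF⇒∀ _ (Bool.∧-conicalʳ _ _ q) b)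
    where
    edge : ∀ b → lookup A b ≡ true → b ≢ a → sinkCondition a b ≡ true → E b a ≡ true
    edge b b∈A b≢a h rewrite b∈A | dec-false (b ≟F a) b≢a = h

  sink⇒cD : ∀ {a} → IsSink a → cD E A ≡ true
  sink⇒cD {a} (a∈A , edges) =
    ∃⇒anyF _ a (subst (λ c → (c ∧ allF (sinkCondition a)) ≡ true) (sym a∈A) (∀⇒allF _ condition))
    where
    condition : ∀ b → sinkCondition a b ≡ true
    condition b with lookup A b in b∈A | b ≟F a
    ... | false | _      = refl
    ... | true  | yes _  = refl
    ... | true  | no b≢a = edges b b∈A b≢a

  no-sink⇒cD≡false : (∀ a → ¬ IsSink a) → cD E A ≡ false
  no-sink⇒cD≡false no-sink with cD E A in eq
  ... | false = refl
  ... | true  = ⊥-elim (no-sink _ (proj₂ (cD⇒sink eq)))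

cD-cong : ∀ {m} {E E′ : Fin m → Fin m → Bool} (A : Subset m) →
  (∀ a b → lookup A a ≡ true → lookup A b ≡ true → E b a ≡ E′ b a) → cD E A ≡ cD E′ A
cD-cong A same = ≡-by-true (transfer same) (transfer (λ a b a∈A b∈A → sym (same a b a∈A b∈A)))
  where
  transfer : ∀ {E E′} → (∀ a b → lookup A a ≡ true → lookup A b ≡ true → E b a ≡ E′ b a) →
    cD E A ≡ true → cD E′ A ≡ true
  transfer {E} {E′} same p =
    let a , a∈A , edges = cD⇒sink E A p
    in sink⇒cD E′ A (a∈A , λ b b∈A b≢a → trans (sym (same a b a∈A b∈A)) (edges b b∈A b≢a))

data NodeView {n : ℕ} : Fin (N n) → Set where
  centre : NodeView (ctr {n})
  leafᵛ  : ∀ j → NodeView (leaf {n} j)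
  primeᵛ : ∀ j → NodeView (prime {n} j)

nodeView : ∀ {n} (x : Fin (N n)) → NodeView {n} x
nodeView zero = centre
nodeView {n} (suc x) with splitAt n x | join-splitAt n n x
... | inj₁ j | refl = leafᵛ j
... | inj₂ j | refl = primeᵛ j

leaf-injective : ∀ {n} {j k : Fin n} → leaf {n} j ≡ leaf k → j ≡ k
leaf-injective {n} {j} {k} = ↑ˡ-injective n j k ∘ suc-injective

leaf≢prime : ∀ {n} {j k : Fin n} → leaf {n} j ≢ prime k
leaf≢prime {n} {j} {k} eq
  with trans (sym (splitAt-↑ˡ n j n)) (trans (cong (splitAt n) (suc-injective eq)) (splitAt-↑ʳ n n k))
... | ()

module _ {n} (c : Bool) (L P : Subset n) where

  lookup-leaf : ∀ j → lookup (c ∷ (L ++ P)) (leaf {n} j) ≡ lookup L j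
  lookup-leaf = lookup-++ˡ L P

  lookup-prime : ∀ j → lookup (c ∷ (L ++ P)) (prime {n} j) ≡ lookup P j
  lookup-prime = lookup-++ʳ L P

module _ {n} (G : Fin (suc n) → Fin (suc n) → Bool) (I : Subset n) where

  GI-leaf-ctr : ∀ j → GI G I (leaf {n} j) (ctr {n}) ≡ G (suc j) zero
  GI-leaf-ctr j rewrite splitAt-↑ˡ n j n = refl

  GI-ctr-leaf : ∀ j → GI G I (ctr {n}) (leaf {n} j) ≡ G zero (suc j)
  GI-ctr-leaf j rewrite splitAt-↑ˡ n j n = refl

  GI-leaf-leaf : ∀ j k → GI G I (leaf {n} j) (leaf {n} k) ≡ G (suc j) (suc k)
  GI-leaf-leaf j k rewrite splitAt-↑ˡ n j n | splitAt-↑ˡ n k n = refl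

  GI-prime-leaf : ∀ j k → GI G I (prime {n} j) (leaf {n} k) ≡ lookup I j ∧ does (suc k ≟F suc j)
  GI-prime-leaf j k rewrite splitAt-↑ʳ n n j | splitAt-↑ˡ n k n = refl

  GI-prime-ctr : ∀ j → GI G I (prime {n} j) (ctr {n}) ≡ false
  GI-prime-ctr j rewrite splitAt-↑ʳ n n j = Bool.∧-zeroʳ (lookup I j)

  GI-→prime : ∀ a j → GI G I a (prime {n} j) ≡ false
  GI-→prime a j rewrite splitAt-↑ʳ n n j with splitAt (suc n) a
  ... | inj₁ _ = refl
  ... | inj₂ _ = refl

GI-cong : ∀ {n} {G G′ : Fin (suc n) → Fin (suc n) → Bool} (I : Subset n) →
  (∀ a b → G a b ≡ G′ a b) → ∀ a b → GI G I a b ≡ GI G′ I a b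
GI-cong {n} I G≗G′ a b with splitAt (suc n) a | splitAt (suc n) b
... | inj₁ a′ | inj₁ b′ = G≗G′ a′ b′
... | inj₁ _  | inj₂ _  = refl
... | inj₂ _  | inj₁ _  = refl
... | inj₂ _  | inj₂ _  = refl

-- DAGs with skeleton S are orientations of the star

-- y is the set of leaves whose edge points into the centre.
starEdges : ∀ {n} → Subset n → Fin (suc n) → Fin (suc n) → Bool
starEdges y zero    zero    = false
starEdges y zero    (suc j) = not (lookup y j)
starEdges y (suc j) zero    = lookup y j
starEdges y (suc j) (suc k) = false

module _ {n} (y : Subset n) where

  private
    height : Fin (suc n) → ℕ
    height zero    = 1
    height (suc j) = if lookup y j then 0 else 2

    edge-ascends : ∀ a b → T (starEdges y a b) → height a < height b
    edge-ascends zero (suc j) _ with lookup y j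
    ... | false = s≤s (s≤s z≤n)
    edge-ascends (suc j) zero _ with lookup y j
    ... | true = s≤s z≤n

    path-ascends : ∀ {a b} → Path (starEdges y) a b → height a < height b
    path-ascends {a} {b} (step e)             = edge-ascends a b e
    path-ascends {a}     (_∷ₚ_ {b = c} e es) = ℕ.<-trans (edge-ascends a c e) (path-ascends es)

    edge⇒adjacent : ∀ a b → T (starEdges y a b ∨ starEdges y b a) → StarAdj a b
    edge⇒adjacent zero    (suc j) _ = inj₁ (refl , λ ())
    edge⇒adjacent (suc j) zero    _ = inj₂ (refl , λ ())

    adjacent⇒edge : ∀ a b → StarAdj a b → T (starEdges y a b ∨ starEdges y b a)
    adjacent⇒edge zero    zero    (inj₁ (_ , b≢0)) = b≢0 refl
    adjacent⇒edge zero    zero    (inj₂ (_ , a≢0)) = a≢0 refl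
    adjacent⇒edge zero    (suc j) _ with lookup y j
    ... | true  = _
    ... | false = _
    adjacent⇒edge (suc j) zero    _ with lookup y j
    ... | true  = _
    ... | false = _
    adjacent⇒edge (suc j) (suc k) (inj₁ (() , _))
    adjacent⇒edge (suc j) (suc k) (inj₂ (() , _))

  orientation : DAG n
  orientation = record
    { G       = starEdges y
    ; acyclic = λ a cycle → ℕ.<-irrefl refl (path-ascends cycle)
    ; skel⇒   = edge⇒adjacent
    ; skel⇐   = adjacent⇒edge
    }

inwardLeaves : ∀ {n} → DAG n → Subset n
inwardLeaves D = tabulate (λ j → DAG.G D (suc j) zero)

DAG≡orientation : ∀ {n} (D : DAG n) a b → DAG.G D a b ≡ starEdges (inwardLeaves D) a b
DAG≡orientation D zero zero with DAG.G D zero zero in loop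
... | false = refl
... | true  = ⊥-elim (DAG.acyclic D zero (step (subst T (sym loop) _)))
DAG≡orientation D zero (suc j) rewrite lookup∘tabulate (λ k → DAG.G D (suc k) zero) j
  with DAG.G D zero (suc j) in out | DAG.G D (suc j) zero in inn
... | true  | true  = ⊥-elim (DAG.acyclic D zero (subst T (sym out) _ ∷ₚ step (subst T (sym inn) _)))
... | true  | false = refl
... | false | true  = refl
... | false | false = ⊥-elim (subst T (cong₂ _∨_ out inn) (DAG.skel⇐ D zero (suc j) (inj₁ (refl , λ ()))))
DAG≡orientation D (suc j) zero = sym (lookup∘tabulate (λ k → DAG.G D (suc k) zero) j)
DAG≡orientation D (suc j) (suc k) with DAG.G D (suc j) (suc k) in e
... | false = refl
... | true with DAG.skel⇒ D (suc j) (suc k) (subst (λ b → T (b ∨ DAG.G D (suc k) (suc j))) (sym e) _)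
...   | inj₁ (() , _)
...   | inj₂ (() , _)

vertex : ∀ {n} → Subset n → Subset n → Point n
vertex I y = cimset I (orientation y)

cimset≡vertex : ∀ {n} (I : Subset n) (D : DAG n) A → cimset I D A ≡ vertex I (inwardLeaves D) A
cimset≡vertex I D A = cong toℚ (cD-cong A (λ a b _ _ → GI-cong I (DAG≡orientation D) b a))

uvv'≡⁅j⁆⁅j⁆ : ∀ {n} (j : Fin n) → uvv' j ≡ inside ∷ (⁅ j ⁆ ++ ⁅ j ⁆)
uvv'≡⁅j⁆⁅j⁆ j rewrite ⊥[j]≔inside≡⁅j⁆ j = refl

centre-free-constant : ∀ {n} (I y y′ : Subset n) X →
  cD (GI (starEdges y) I) (outside ∷ X) ≡ cD (GI (starEdges y′) I) (outside ∷ X)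
centre-free-constant {n} I y y′ X = cD-cong (outside ∷ X) same
  where
  same : ∀ a b → lookup (outside ∷ X) a ≡ true → lookup (outside ∷ X) b ≡ true →
    GI (starEdges y) I b a ≡ GI (starEdges y′) I b a
  same (suc a) (suc b) _ _ with splitAt n a | splitAt n b
  ... | inj₁ _ | inj₁ _ = refl
  ... | inj₁ _ | inj₂ _ = refl
  ... | inj₂ _ | inj₁ _ = refl
  ... | inj₂ _ | inj₂ _ = refl

module OrientationValues {n} (I y : Subset n) where

  private
    E = GI (starEdges y) I

    absurd : ∀ {b} → b ≡ true → b ≡ false → ∀ {a} {A : Set a} → A
    absurd b≡true b≡false = ⊥-elim (true≢false (trans (sym b≡true) b≡false))

  value-centre : ∀ C → 2 ≤ ∣ C ∣ → cD E (inside ∷ (C ++ ⊥)) ≡ does (C ⊆? y)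
  value-centre C 2≤∣C∣ = ≡-by-true sink⇒⊆ ⊆⇒sink
    where
    A = inside ∷ (C ++ ⊥)
    sink⇒⊆ : cD E A ≡ true → does (C ⊆? y) ≡ true
    sink⇒⊆ p with cD⇒sink E A p
    ... | a , a∈A , edges with nodeView {n} a
    ...   | centre = dec-true (C ⊆? y) λ {j} j∈C → lookup⇒[]= j y
      (trans (sym (GI-leaf-ctr (starEdges y) I j))
             (edges (leaf {n} j) (trans (lookup-leaf inside C ⊥ j) ([]=⇒lookup j∈C)) (λ ())))
    ...   | leafᵛ j =
      let k , k≢j , k∈C = another-member C 2≤∣C∣ j
      in absurd (edges (leaf {n} k) (trans (lookup-leaf inside C ⊥ k) k∈C) (k≢j ∘ leaf-injective))
                (GI-leaf-leaf (starEdges y) I k j)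
    ...   | primeᵛ j = absurd a∈A (trans (lookup-prime inside C ⊥ j) (lookup-⊥ j))
    ⊆⇒sink : does (C ⊆? y) ≡ true → cD E A ≡ true
    ⊆⇒sink p = sink⇒cD E A (refl , into-centre)
      where
      into-centre : ∀ b → lookup A b ≡ true → b ≢ ctr {n} → E b (ctr {n}) ≡ true
      into-centre b b∈A b≢ctr with nodeView {n} b
      ... | centre   = ⊥-elim (b≢ctr refl)
      ... | leafᵛ j  = trans (GI-leaf-ctr (starEdges y) I j)
        ([]=⇒lookup (witness (C ⊆? y) p (lookup⇒[]= j C (trans (sym (lookup-leaf inside C ⊥ j)) b∈A))))
      ... | primeᵛ j = absurd b∈A (trans (lookup-prime inside C ⊥ j) (lookup-⊥ j))

  value-singleton : ∀ j → cD E (inside ∷ (⁅ j ⁆ ++ ⊥)) ≡ true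
  value-singleton j with lookup y j in j∈y
  ... | true  = sink⇒cD E A (refl , into-centre)
    where
    A = inside ∷ (⁅ j ⁆ ++ ⊥)
    into-centre : ∀ b → lookup A b ≡ true → b ≢ ctr {n} → E b (ctr {n}) ≡ true
    into-centre b b∈A b≢ctr with nodeView {n} b
    ... | centre   = ⊥-elim (b≢ctr refl)
    ... | leafᵛ k with lookup-⁅y⁆⇒≡ j k (trans (sym (lookup-leaf inside ⁅ j ⁆ ⊥ k)) b∈A)
    ...   | refl = trans (GI-leaf-ctr (starEdges y) I k) j∈y
    into-centre b b∈A b≢ctr | primeᵛ k = absurd b∈A (trans (lookup-prime inside ⁅ j ⁆ ⊥ k) (lookup-⊥ k))
  ... | false = sink⇒cD E A (trans (lookup-leaf inside ⁅ j ⁆ ⊥ j) (lookup-⁅x⁆ j) , into-leaf)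
    where
    A = inside ∷ (⁅ j ⁆ ++ ⊥)
    into-leaf : ∀ b → lookup A b ≡ true → b ≢ leaf {n} j → E b (leaf {n} j) ≡ true
    into-leaf b b∈A b≢j with nodeView {n} b
    ... | centre   = trans (GI-ctr-leaf (starEdges y) I j) (cong not j∈y)
    ... | leafᵛ k  =
      ⊥-elim (b≢j (cong (leaf {n}) (lookup-⁅y⁆⇒≡ j k (trans (sym (lookup-leaf inside ⁅ j ⁆ ⊥ k)) b∈A))))
    ... | primeᵛ k = absurd b∈A (trans (lookup-prime inside ⁅ j ⁆ ⊥ k) (lookup-⊥ k))

  value-uvv' : ∀ j → lookup I j ≡ true → cD E (uvv' j) ≡ not (lookup y j)
  value-uvv' j j∈I = trans (cong (cD E) (uvv'≡⁅j⁆⁅j⁆ j)) value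
    where
    value : cD E (inside ∷ (⁅ j ⁆ ++ ⁅ j ⁆)) ≡ not (lookup y j)
    value with lookup y j in j∈y
    ... | false = sink⇒cD E A (trans (lookup-leaf inside ⁅ j ⁆ ⁅ j ⁆ j) (lookup-⁅x⁆ j) , into-leaf)
      where
      A = inside ∷ (⁅ j ⁆ ++ ⁅ j ⁆)
      into-leaf : ∀ b → lookup A b ≡ true → b ≢ leaf {n} j → E b (leaf {n} j) ≡ true
      into-leaf b b∈A b≢j with nodeView {n} b
      ... | centre   = trans (GI-ctr-leaf (starEdges y) I j) (cong not j∈y)
      ... | leafᵛ k  =
        ⊥-elim (b≢j (cong (leaf {n}) (lookup-⁅y⁆⇒≡ j k (trans (sym (lookup-leaf inside ⁅ j ⁆ ⁅ j ⁆ k)) b∈A))))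
      ... | primeᵛ k with lookup-⁅y⁆⇒≡ j k (trans (sym (lookup-prime inside ⁅ j ⁆ ⁅ j ⁆ k)) b∈A)
      ...   | refl rewrite GI-prime-leaf (starEdges y) I k k | j∈I = dec-true (suc k ≟F suc k) refl
    ... | true = no-sink⇒cD≡false E A no-sink
      where
      A = inside ∷ (⁅ j ⁆ ++ ⁅ j ⁆)
      no-sink : ∀ a → ¬ IsSink E A a
      no-sink a (a∈A , edges) with nodeView {n} a
      ... | centre = absurd (edges (prime {n} j) (trans (lookup-prime inside ⁅ j ⁆ ⁅ j ⁆ j) (lookup-⁅x⁆ j)) (λ ()))
                            (GI-prime-ctr (starEdges y) I j)
      ... | leafᵛ k with lookup-⁅y⁆⇒≡ j k (trans (sym (lookup-leaf inside ⁅ j ⁆ ⁅ j ⁆ k)) a∈A)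
      ...   | refl = absurd (edges (ctr {n}) refl (λ ())) (trans (GI-ctr-leaf (starEdges y) I k) (cong not j∈y))
      no-sink a (a∈A , edges) | primeᵛ k = absurd (edges (ctr {n}) refl (λ ())) (GI-→prime (starEdges y) I (ctr {n}) k)

  prime∈⇒uvv' : ∀ L P j → lookup P j ≡ true → cD E (inside ∷ (L ++ P)) ≡ true → inside ∷ (L ++ P) ≡ uvv' j
  prime∈⇒uvv' L P j j∈P p with cD⇒sink E (inside ∷ (L ++ P)) p
  ... | a , a∈A , edges with nodeView {n} a
  ...   | centre   = absurd (edges (prime {n} j) j∈A (λ ())) (GI-prime-ctr (starEdges y) I j)
    where j∈A = trans (lookup-prime inside L P j) j∈P
  ...   | primeᵛ k = absurd (edges (ctr {n}) refl (λ ())) (GI-→prime (starEdges y) I (ctr {n}) k)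
  ...   | leafᵛ k with suc-injective (witness (suc k ≟F suc j) (Bool.∧-conicalʳ _ _
                        (trans (sym (GI-prime-leaf (starEdges y) I j k))
                               (edges (prime {n} j) (trans (lookup-prime inside L P j) j∈P) (leaf≢prime {n} ∘ sym)))))
  ...     | refl = trans (cong₂ (λ L P → inside ∷ (L ++ P)) (sole-member⇒≡⁅⁆ {p = L} k∈L only-k-L)
                                                         (sole-member⇒≡⁅⁆ {p = P} j∈P only-k-P))
                       (sym (uvv'≡⁅j⁆⁅j⁆ k))
    where
    k∈L = trans (sym (lookup-leaf inside L P k)) a∈A
    only-k-L : ∀ m → lookup L m ≡ true → m ≡ k
    only-k-L m m∈L with m ≟F k
    ... | yes m≡k = m≡k
    ... | no  m≢k = absurd (edges (leaf {n} m) (trans (lookup-leaf inside L P m) m∈L) (m≢k ∘ leaf-injective))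
                           (GI-leaf-leaf (starEdges y) I m k)
    only-k-P : ∀ m → lookup P m ≡ true → m ≡ k
    only-k-P m m∈P with m ≟F k
    ... | yes m≡k = m≡k
    ... | no  m≢k = absurd (edges (prime {n} m) (trans (lookup-prime inside L P m) m∈P) (leaf≢prime {n} ∘ sym))
      (trans (GI-prime-leaf (starEdges y) I m k)
             (trans (cong (lookup I m ∧_) (dec-false (suc k ≟F suc m) (m≢k ∘ sym ∘ suc-injective))) (Bool.∧-zeroʳ _)))

-- Free sets and the coordinates on which CIM_S^I varies

Free : ∀ {n} → Subset n → Subset n → Set
Free I C = 2 ≤ ∣ C ∣ ⊎ ∃ λ j → lookup I j ≡ true × C ≡ ⁅ j ⁆

free? : ∀ {n} (I C : Subset n) → Dec (Free I C)
free? I C = 2 ℕ.≤? ∣ C ∣ ⊎-dec any? (λ j → (lookup I j Bool.≟ true) ×-dec ≡-dec Bool._≟_ C ⁅ j ⁆)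

freeCoordinate : ∀ {n} → Subset n → Subset (N n)
freeCoordinate C = inside ∷ (C ++ (if does (∣ C ∣ ℕ.≟ 1) then C else ⊥))

freeCoordinate-big : ∀ {n} (C : Subset n) → 2 ≤ ∣ C ∣ → freeCoordinate C ≡ inside ∷ (C ++ ⊥)
freeCoordinate-big C 2≤∣C∣
  rewrite dec-false (∣ C ∣ ℕ.≟ 1) (λ ∣C∣≡1 → ℕ.<-irrefl refl (subst (2 ≤_) ∣C∣≡1 2≤∣C∣)) = refl

freeCoordinate-⁅⁆ : ∀ {n} (j : Fin n) → freeCoordinate ⁅ j ⁆ ≡ uvv' j
freeCoordinate-⁅⁆ j rewrite ∣⁅x⁆∣≡1 j = sym (uvv'≡⁅j⁆⁅j⁆ j)

module _ {n} (I : Subset n) where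

  centre-coordinate : ∀ C → 1 ≤ ∣ C ∣ → IsCoord n I (inside ∷ (C ++ ⊥))
  centre-coordinate C 1≤∣C∣ =
    s≤s (subst (1 ≤_) (sym (∣L++⊥∣ C)) 1≤∣C∣) ,
    λ j j∈A → ⊥-elim (true≢false (trans (sym j∈A) (trans (lookup-prime inside C ⊥ j) (lookup-⊥ j))))

  uvv'-coordinate : ∀ j → lookup I j ≡ true → IsCoord n I (uvv' j)
  uvv'-coordinate j j∈I = subst (IsCoord n I) (sym (uvv'≡⁅j⁆⁅j⁆ j))
    ( s≤s (subst (1 ≤_) (sym (trans (∣++∣ ⁅ j ⁆ ⁅ j ⁆) (cong₂ ℕ._+_ (∣⁅x⁆∣≡1 j) (∣⁅x⁆∣≡1 j)))) (s≤s z≤n))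
    , λ k k∈A → subst (λ z → lookup I z ≡ true)
                      (sym (lookup-⁅y⁆⇒≡ j k (trans (sym (lookup-prime inside ⁅ j ⁆ ⁅ j ⁆ k)) k∈A))) j∈I )

  freeCoordinate-coordinate : ∀ C → Free I C → IsCoord n I (freeCoordinate C)
  freeCoordinate-coordinate C (inj₁ 2≤∣C∣) =
    subst (IsCoord n I) (sym (freeCoordinate-big C 2≤∣C∣)) (centre-coordinate C (ℕ.≤-trans (s≤s z≤n) 2≤∣C∣))
  freeCoordinate-coordinate _ (inj₂ (j , j∈I , refl)) =
    subst (IsCoord n I) (sym (freeCoordinate-⁅⁆ j)) (uvv'-coordinate j j∈I)

  vertex-big : ∀ y C → 2 ≤ ∣ C ∣ → vertex I y (freeCoordinate C) ≡ ζ C y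
  vertex-big y C 2≤∣C∣ = cong toℚ (trans (cong (cD (GI (starEdges y) I)) (freeCoordinate-big C 2≤∣C∣))
                                           (OrientationValues.value-centre I y C 2≤∣C∣))

  vertex-uvv' : ∀ y j → lookup I j ≡ true → vertex I y (uvv' j) ≡ toℚ (not (lookup y j))
  vertex-uvv' y j j∈I = cong toℚ (OrientationValues.value-uvv' I y j j∈I)

  Constant : Subset (N n) → Set
  Constant A = ∀ y → vertex I y A ≡ vertex I ⊥ A

  IsFreeCoordinate : Subset (N n) → Set
  IsFreeCoordinate A = ∃ λ C → Free I C × A ≡ freeCoordinate C

  private
    with-prime : ∀ L P j → lookup P j ≡ true → IsCoord n I (inside ∷ (L ++ P)) →
      IsFreeCoordinate (inside ∷ (L ++ P)) ⊎ Constant (inside ∷ (L ++ P))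
    with-prime L P j j∈P A-coord with ≡-dec Bool._≟_ (inside ∷ (L ++ P)) (uvv' j)
    ... | yes A≡uvv' = inj₁ (⁅ j ⁆ , inj₂ (j , j∈I , refl) , trans A≡uvv' (sym (freeCoordinate-⁅⁆ j)))
      where j∈I = proj₂ A-coord j (trans (lookup-prime inside L P j) j∈P)
    ... | no  A≢uvv' = inj₂ λ y → cong toℚ (trans (never y) (sym (never ⊥)))
      where
      never : ∀ y → cD (GI (starEdges y) I) (inside ∷ (L ++ P)) ≡ false
      never y = Bool.¬-not (A≢uvv' ∘ OrientationValues.prime∈⇒uvv' I y L P j j∈P)

    leaves-only : ∀ L → IsCoord n I (inside ∷ (L ++ ⊥)) →
      IsFreeCoordinate (inside ∷ (L ++ ⊥)) ⊎ Constant (inside ∷ (L ++ ⊥))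
    leaves-only L A-coord with 2 ℕ.≤? ∣ L ∣
    ... | yes 2≤∣L∣ = inj₁ (L , inj₁ 2≤∣L∣ , sym (freeCoordinate-big L 2≤∣L∣))
    ... | no  2≰∣L∣ = inj₂ λ y → cong toℚ (trans (singleton y) (sym (singleton ⊥)))
      where
      member = some-member L (subst (1 ≤_) (∣L++⊥∣ L) (ℕ.s≤s⁻¹ (proj₁ A-coord)))
      j = proj₁ member
      L≡⁅j⁆ : L ≡ ⁅ j ⁆
      L≡⁅j⁆ = sole-member⇒≡⁅⁆ (proj₂ member) λ k k∈L →
        decidable-stable (k ≟F j) (λ k≢j → 2≰∣L∣ (two-members⇒2≤∣∣ L k∈L (proj₂ member) k≢j))
      singleton : ∀ y → cD (GI (starEdges y) I) (inside ∷ (L ++ ⊥)) ≡ true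
      singleton y = subst (λ C → cD (GI (starEdges y) I) (inside ∷ (C ++ ⊥)) ≡ true) (sym L≡⁅j⁆)
                          (OrientationValues.value-singleton I y j)

  classify-coordinate : ∀ A → IsCoord n I A → IsFreeCoordinate A ⊎ Constant A
  classify-coordinate (outside ∷ X) _ = inj₂ λ y → cong toℚ (centre-free-constant I y ⊥ X)
  classify-coordinate (inside ∷ X) A-coord with Vec.splitAt n X
  ... | L , P , refl with nonempty? P
  ...   | yes (j , j∈P) = with-prime L P j ([]=⇒lookup j∈P) A-coord
  ...   | no  P-empty with Empty-unique P-empty
  ...     | refl = leaves-only L A-coord

withCtrLeaf-coordinate : ∀ {n} (I : Subset n) i B → IsCoord n I (withCtrLeaf i B)
withCtrLeaf-coordinate I i B =
  centre-coordinate I (B [ i ]≔ inside) (member⇒1≤∣∣ (B [ i ]≔ inside) (lookup∘update i B inside))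

bidirected-linear : ∀ {n} (I : Subset n) i → lookup I i ≡ true → Linear I (bidirected i)
bidirected-linear I i i∈I = linear-+ I (linear-eval I (uvv' i) (uvv'-coordinate I i i∈I)) (linear-sumSub I summand)
  where
  summand : ∀ B →
    Linear I (λ x → if not (lookup B i) ∧ does (1 ℕ.≤? ∣ B ∣) then sgn ∣ B ∣ * x (withCtrLeaf i B) else 0ℚ)
  summand B with not (lookup B i) ∧ does (1 ℕ.≤? ∣ B ∣)
  ... | true  = linear-scale I (sgn ∣ B ∣) (linear-eval I (withCtrLeaf i B) (withCtrLeaf-coordinate I i B))
  ... | false = linear-0 I

module _ {n} (I : Subset n) (i : Fin n) (i∈I : lookup I i ≡ true) (y : Subset n) where

  private
    K = y [ i ]≔ outside

    2≤∣B∪i∣ : ∀ B → lookup B i ≡ false → does (1 ℕ.≤? ∣ B ∣) ≡ true → 2 ℕ.≤ ∣ B [ i ]≔ inside ∣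
    2≤∣B∪i∣ B i∉B nonempty =
      subst (2 ℕ.≤_) (sym (∣[]≔inside∣ B i i∉B)) (s≤s (witness (1 ℕ.≤? ∣ B ∣) nonempty))

    -- For i ∉ B, [B ∪ {i} ⊆ y] = [i ∈ y]·[B ⊆ y − i]; for i ∈ B the right-hand side vanishes,
    -- so the restriction to B ∌ i disappears.
    summand-at-vertex : ∀ B →
      (if not (lookup B i) ∧ does (1 ℕ.≤? ∣ B ∣) then sgn ∣ B ∣ * vertex I y (withCtrLeaf i B) else 0ℚ) ≡
      toℚ (lookup y i) * (if does (1 ℕ.≤? ∣ B ∣) then sgn ∣ B ∣ * ζ B K else 0ℚ)
    summand-at-vertex B with lookup B i in i∈B | does (1 ℕ.≤? ∣ B ∣) in 1≤∣B∣
    ... | true  | false = sym (*-zeroʳ (toℚ (lookup y i)))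
    ... | true  | true  rewrite ⊆?-[]≔outside B y i i∈B =
      sym (trans (cong (toℚ (lookup y i) *_) (*-zeroʳ (sgn ∣ B ∣))) (*-zeroʳ (toℚ (lookup y i))))
    ... | false | false = sym (*-zeroʳ (toℚ (lookup y i)))
    ... | false | true  rewrite OrientationValues.value-centre I y (B [ i ]≔ inside) (2≤∣B∪i∣ B i∈B 1≤∣B∣)
                              | ⊆?-[]≔inside B y i i∈B with lookup y i
    ...   | true  = sym (*-identityˡ _)
    ...   | false = trans (*-zeroʳ (sgn ∣ B ∣)) (sym (*-zeroˡ (sgn ∣ B ∣ * ζ B K)))

  bidirected-vertex : bidirected i (vertex I y) ≡ toℚ (not (lookup y i ∧ does ((y [ i ]≔ outside) ⊆? ⊥)))
  bidirected-vertex = begin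
    vertex I y (uvv' i) + ind-u←v i (vertex I y)
      ≡⟨ cong₂ _+_ (vertex-uvv' I y i i∈I) (sumSub-cong summand-at-vertex) ⟩
    toℚ (not a) + sumSub (λ B → toℚ a * nonempty-term B)
      ≡⟨ cong (toℚ (not a) +_) (*-distribˡ-sumSub (toℚ a) nonempty-term) ⟩
    toℚ (not a) + toℚ a * sumSub nonempty-term
      ≡⟨ cong (λ s → toℚ (not a) + toℚ a * s) (sumSub-nonempty term) ⟩
    toℚ (not a) + toℚ a * (sumSub term + - term ⊥)
      ≡⟨ cong₂ (λ s t → toℚ (not a) + toℚ a * (s + - t)) alternating empty-term ⟩
    toℚ (not a) + toℚ a * (sgn 0 * ζ K ⊥ + - (sgn 0 * 1ℚ))
      ≡⟨ combine a (does (K ⊆? ⊥)) ⟩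
    toℚ (not (a ∧ does (K ⊆? ⊥)))
      ∎
    where
    open ≡-Reasoning
    a = lookup y i
    term : Subset n → ℚ
    term B = sgn ∣ B ∣ * ζ B K
    nonempty-term : Subset n → ℚ
    nonempty-term B = if does (1 ℕ.≤? ∣ B ∣) then term B else 0ℚ
    alternating : sumSub term ≡ sgn 0 * ζ K ⊥
    alternating = trans (sumSub-cong (λ B → cong (λ k → sgn k * ζ B K) (sym (ℕ.+-identityʳ ∣ B ∣))))
                        (sumSub-sgn-ζ K 0)
    empty-term : term ⊥ ≡ sgn 0 * 1ℚ
    empty-term = cong₂ (λ k b → sgn k * toℚ b) (∣⊥∣≡0 n) (dec-true (⊥ ⊆? K) ⊥⊆)
    combine : ∀ a e → toℚ (not a) + toℚ a * (sgn 0 * toℚ e + - (sgn 0 * 1ℚ)) ≡ toℚ (not (a ∧ e))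
    combine true  true  = refl
    combine true  false = refl
    combine false true  = refl
    combine false false = refl

module _ {n} (I : Subset n) (i : Fin n) (i∈I : lookup I i ≡ true) where

  bidirected-at-⁅i⁆ : bidirected i (vertex I ⁅ i ⁆) ≡ 0ℚ
  bidirected-at-⁅i⁆ = trans (bidirected-vertex I i i∈I ⁅ i ⁆)
    (cong (λ b → toℚ (not b)) (cong₂ _∧_ (lookup-⁅x⁆ i)
      (trans (cong (λ K → does (K ⊆? ⊥)) (⁅i⁆[i]≔outside≡⊥ i)) (dec-true (⊥ {n} ⊆? ⊥) ⊆-refl))))

  bidirected-at-≢⁅i⁆ : ∀ y → y ≢ ⁅ i ⁆ → bidirected i (vertex I y) ≡ 1ℚ
  bidirected-at-≢⁅i⁆ y y≢⁅i⁆ = trans (bidirected-vertex I i i∈I y) (cong (λ b → toℚ (not b)) not-singleton)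
    where
    K = y [ i ]≔ outside
    not-singleton : (lookup y i ∧ does (K ⊆? ⊥)) ≡ false
    not-singleton with lookup y i in i∈y | K ⊆? ⊥
    ... | false | _         = refl
    ... | true  | no _      = refl
    ... | true  | yes K⊆⊥ = contradiction (sole-member⇒≡⁅⁆ i∈y only-i) y≢⁅i⁆
      where
      only-i : ∀ k → lookup y k ≡ true → k ≡ i
      only-i k k∈y = decidable-stable (k ≟F i) λ k≢i →
        ∉⊥ (K⊆⊥ (lookup⇒[]= k K (trans (lookup∘update′ k≢i y outside) k∈y)))

  bidirected-valid : Valid n I (bidirected i)
  bidirected-valid = valid-on-vertices⇒valid I linear λ D →
    subst (ℚ._≤ 1ℚ) (sym (Linear.local linear (λ A _ → cimset≡vertex I D A))) (at-vertex (inwardLeaves D))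
    where
    linear = bidirected-linear I i i∈I
    toℚ≤1 : ∀ b → toℚ b ℚ.≤ 1ℚ
    toℚ≤1 true  = ≤-refl
    toℚ≤1 false = ≤ᵇ⇒≤ _
    at-vertex : ∀ y → bidirected i (vertex I y) ℚ.≤ 1ℚ
    at-vertex y = subst (ℚ._≤ 1ℚ) (sym (bidirected-vertex I i i∈I y))
                        (toℚ≤1 (not (lookup y i ∧ does ((y [ i ]≔ outside) ⊆? ⊥))))

-- Affinely independent vertices and the dimension bound

allSubsets : ∀ n → List (Subset n)
allSubsets zero    = [] ∷ []
allSubsets (suc n) = map (inside ∷_) (allSubsets n) List.++ map (outside ∷_) (allSubsets n)

allSubsets-complete : ∀ {n} (C : Subset n) → C ∈ˡ allSubsets n
allSubsets-complete []                  = here refl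
allSubsets-complete {suc n} (true  ∷ C) = ∈-++⁺ˡ (∈-map⁺ (inside ∷_) (allSubsets-complete C))
allSubsets-complete {suc n} (false ∷ C) =
  ∈-++⁺ʳ (map (inside ∷_) (allSubsets n)) (∈-map⁺ (outside ∷_) (allSubsets-complete C))

allSubsets-unique : ∀ n → Unique (allSubsets n)
allSubsets-unique zero    = [] ∷ []
allSubsets-unique (suc n) =
  Unique.++⁺ (Unique.map⁺ ∷-injectiveʳ (allSubsets-unique n)) (Unique.map⁺ ∷-injectiveʳ (allSubsets-unique n)) disjoint
  where
  disjoint : ∀ {C} → ¬ (C ∈ˡ map (inside ∷_) (allSubsets n) × C ∈ˡ map (outside ∷_) (allSubsets n))
  disjoint (p , q) with ∈-map⁻ (inside ∷_) p | ∈-map⁻ (outside ∷_) q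
  ... | _ , _ , refl | _ , _ , ()

lookup-injective : ∀ {a} {A : Set a} {xs : List A} → Unique xs →
  ∀ {r r′} → List.lookup xs r ≡ List.lookup xs r′ → r ≡ r′
lookup-injective (_   ∷ _) {zero}  {zero}   _  = refl
lookup-injective (x≢ ∷ _) {zero}  {suc r′} eq = contradiction eq (All.lookup x≢ (∈-lookup r′))
lookup-injective (x≢ ∷ _) {suc r} {zero}   eq = contradiction (sym eq) (All.lookup x≢ (∈-lookup r))
lookup-injective (_   ∷ u) {suc r} {suc r′} eq = cong suc (lookup-injective u eq)

module _ {n} (I : Subset n) where

  vertex∈CIM : ∀ y → CIM n I (vertex I y)
  vertex∈CIM y = (1ℚ , orientation y) ∷ [] , ≤ᵇ⇒≤ _ ∷ [] , +-identityʳ 1ℚ ,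
    λ A _ → sym (trans (+-identityʳ _) (*-identityˡ _))

  ζ⁅j⁆≡1-vertex-uvv' : ∀ {j} → lookup I j ≡ true → ∀ y → ζ ⁅ j ⁆ y ≡ 1ℚ + - vertex I y (uvv' j)
  ζ⁅j⁆≡1-vertex-uvv' {j} j∈I y rewrite ⁅j⁆⊆?-does j y | vertex-uvv' I y j j∈I with lookup y j
  ... | true  = refl
  ... | false = refl

  ζ-row-vanishes : ∀ {k} (μ : Fin k → ℚ) (ys : Fin k → Subset n) → sumFin μ ≡ 0ℚ →
    (∀ A → IsCoord n I A → sumFin (λ r → μ r * vertex I (ys r) A) ≡ 0ℚ) →
    ∀ C → C ≡ ⊥ ⊎ Free I C → sum (λ r → μ r * ζ C (ys r)) ≡ 0ℚ
  ζ-row-vanishes μ ys ∑μ≡0 combination≡0 = row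
    where
    open ≡-Reasoning
    ∑μ≡0′ : sum μ ≡ 0ℚ
    ∑μ≡0′ = trans (sym (sumFin≡sum μ)) ∑μ≡0
    ∑μv≡0 : ∀ A → IsCoord n I A → sum (λ r → μ r * vertex I (ys r) A) ≡ 0ℚ
    ∑μv≡0 A A-coord = trans (sym (sumFin≡sum (λ r → μ r * vertex I (ys r) A))) (combination≡0 A A-coord)
    row : ∀ C → C ≡ ⊥ ⊎ Free I C → sum (λ r → μ r * ζ C (ys r)) ≡ 0ℚ
    row _ (inj₁ refl) = begin
      sum (λ r → μ r * ζ ⊥ (ys r))
        ≡⟨ sum-cong-≗ (λ r → trans (cong (λ b → μ r * toℚ b) (dec-true (⊥ ⊆? ys r) ⊥⊆)) (*-identityʳ (μ r))) ⟩
      sum μ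
        ≡⟨ ∑μ≡0′ ⟩
      0ℚ
        ∎
    row C (inj₂ (inj₁ 2≤∣C∣)) = begin
      sum (λ r → μ r * ζ C (ys r))
        ≡⟨ sum-cong-≗ (λ r → cong (μ r *_) (sym (vertex-big I (ys r) C 2≤∣C∣))) ⟩
      sum (λ r → μ r * vertex I (ys r) (freeCoordinate C))
        ≡⟨ ∑μv≡0 (freeCoordinate C) (freeCoordinate-coordinate I C (inj₁ 2≤∣C∣)) ⟩
      0ℚ
        ∎
    row _ (inj₂ (inj₂ (j , j∈I , refl))) = begin
      sum (λ r → μ r * ζ ⁅ j ⁆ (ys r))
        ≡⟨ sum-cong-≗ (λ r → trans (cong (μ r *_) (ζ⁅j⁆≡1-vertex-uvv' j∈I (ys r)))
                                   (solve 2 (λ m v → m :* (con 1ℚ :+ :- v) := m :+ con (- 1ℚ) :* (m :* v)) refl (μ r) _)) ⟩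
      sum (λ r → μ r + - 1ℚ * v r)
        ≡⟨ ∑-distrib-+ μ (λ r → - 1ℚ * v r) ⟩
      sum μ + sum (λ r → - 1ℚ * v r)
        ≡⟨ cong (sum μ +_) (*-distribˡ-sum (- 1ℚ) v) ⟨
      sum μ + - 1ℚ * sum v
        ≡⟨ cong₂ (λ s t → s + - 1ℚ * t) ∑μ≡0′ (∑μv≡0 (uvv' j) (uvv'-coordinate I j j∈I)) ⟩
      0ℚ
        ∎
      where
      v : Fin _ → ℚ
      v r = μ r * vertex I (ys r) (uvv' j)

  vertices-AffInd : (Bs : List (Subset n)) → Unique Bs → All (λ B → B ≡ ⊥ ⊎ Free I B) Bs →
    AffInd n I (λ r → vertex I (List.lookup Bs r))
  vertices-AffInd Bs unique kinds μ ∑μ≡0 combination≡0 =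
    ζ-unitriangular (List.lookup Bs) (lookup-injective unique) μ λ r →
      ζ-row-vanishes μ (List.lookup Bs) ∑μ≡0 combination≡0 _ (All.lookup kinds (∈-lookup r))

  CIM-¬AffInd : (Cs : List (Subset n)) → (∀ C → Free I C → C ∈ˡ Cs) →
    (p : Fin (suc (suc (length Cs))) → Point n) → (∀ j → CIM n I (p j)) → ¬ AffInd n I p
  CIM-¬AffInd Cs complete = ¬AffInd-few-free-coordinates I (CIM n I) (freeCoordinate ∘ List.lookup Cs) free-or-fixed
    where
    free-or-fixed : ∀ A → IsCoord n I A →
      (∃ λ r → A ≡ freeCoordinate (List.lookup Cs r)) ⊎ (∃ λ κ → ∀ x → CIM n I x → x A ≡ κ)
    free-or-fixed A A-coord with classify-coordinate I A A-coord
    ... | inj₁ (C , free , refl) = let C∈Cs = complete C free in inj₁ (index C∈Cs , cong freeCoordinate (lookup-index C∈Cs))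
    ... | inj₂ constant = inj₂ (vertex I ⊥ A , λ x x∈CIM →
      CIM-constant-coordinate I (λ D → trans (cimset≡vertex I D A) (constant (inwardLeaves D))) x∈CIM A-coord)

module Dimension {n} (I : Subset n) (i : Fin n) (i∈I : lookup I i ≡ true) where

  FreeNot⁅i⁆ : Subset n → Set
  FreeNot⁅i⁆ C = Free I C × C ≢ ⁅ i ⁆

  others : List (Subset n)
  others = filter (λ C → free? I C ×-dec ¬? (≡-dec Bool._≟_ C ⁅ i ⁆)) (allSubsets n)

  others-free : All FreeNot⁅i⁆ others
  others-free = all-filter _ (allSubsets n)

  free-complete : ∀ C → Free I C → C ∈ˡ (⁅ i ⁆ ∷ others)
  free-complete C free with ≡-dec Bool._≟_ C ⁅ i ⁆
  ... | yes refl    = here refl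
  ... | no  C≢⁅i⁆ = there (∈-filter⁺ _ (allSubsets-complete C) (free , C≢⁅i⁆))

  ⊥≢free : ∀ {C} → Free I C → ⊥ ≢ C
  ⊥≢free (inj₁ 2≤∣C∣) refl = contradiction (subst (2 ℕ.≤_) (∣⊥∣≡0 n) 2≤∣C∣) λ ()
  ⊥≢free (inj₂ (j , _ , refl)) ⊥≡⁅j⁆ =
    true≢false (trans (sym (lookup-⁅x⁆ j)) (trans (cong (λ C → lookup C j) (sym ⊥≡⁅j⁆)) (lookup-⊥ j)))

  ⊥∉others : All (⊥ ≢_) others
  ⊥∉others = All.map (⊥≢free ∘ proj₁) others-free

  others-unique : Unique others
  others-unique = Unique.filter⁺ _ (allSubsets-unique n)

  full-list : List (Subset n)
  full-list = ⊥ ∷ ⁅ i ⁆ ∷ others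

  full-unique : Unique full-list
  full-unique = (⊥≢free (inj₂ (i , i∈I , refl)) ∷ ⊥∉others)
              ∷ All.map (λ (_ , C≢⁅i⁆) → C≢⁅i⁆ ∘ sym) others-free
              ∷ others-unique

  face-list : List (Subset n)
  face-list = ⊥ ∷ others

  face-unique : Unique face-list
  face-unique = ⊥∉others ∷ others-unique

  face-avoids-⁅i⁆ : All (_≢ ⁅ i ⁆) face-list
  face-avoids-⁅i⁆ = (⊥≢free (inj₂ (i , i∈I , refl))) ∷ All.map proj₂ others-free

  full-kinds : All (λ B → B ≡ ⊥ ⊎ Free I B) full-list
  full-kinds = inj₁ refl ∷ inj₂ (inj₂ (i , i∈I , refl)) ∷ All.map (inj₂ ∘ proj₁) others-free

  face-kinds : All (λ B → B ≡ ⊥ ⊎ Free I B) face-list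
  face-kinds = inj₁ refl ∷ All.map (inj₂ ∘ proj₁) others-free

  CIM-dimension : HasDim n I (CIM n I) (suc (length others))
  CIM-dimension = ( (λ r → vertex I (List.lookup full-list r)) , (λ _ → vertex∈CIM I _)
                  , vertices-AffInd I full-list full-unique full-kinds )
                , CIM-¬AffInd I (⁅ i ⁆ ∷ others) free-complete

  face-dimension : HasDim n I (λ x → CIM n I x × bidirected i x ≡ 1ℚ) (length others)
  face-dimension =
    ( (λ r → vertex I (List.lookup face-list r))
    , (λ r → vertex∈CIM I _ , bidirected-at-≢⁅i⁆ I i i∈I _ (All.lookup face-avoids-⁅i⁆ (∈-lookup r)))
    , vertices-AffInd I face-list face-unique face-kinds )
    , λ p p∈face affInd → proj₂ CIM-dimension (vertex I ⁅ i ⁆ Vector.∷ p)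
        (λ { zero → vertex∈CIM I ⁅ i ⁆ ; (suc j) → proj₁ (p∈face j) })
        (AffInd-∷ I (bidirected-linear I i i∈I) _ p (bidirected-at-⁅i⁆ I i i∈I) (proj₂ ∘ p∈face) affInd)

lemma5p8 : (n : ℕ) → 2 ≤ n → (I : Subset n) → (i : Fin n) → i ∈ I →
    Valid n I (bidirected i) × Facet n I (bidirected i)
lemma5p8 n _ I i i∈I = valid , valid , length others , CIM-dimension , face-dimension
  where
  open Dimension I i ([]=⇒lookup i∈I)
  valid = bidirected-valid I i ([]=⇒lookup i∈I)
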